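{- Let $\mathcal{C}$ be a clutter with a neighborhood containment pair $(v,e)$. Then $\sigma=e\setminus\{v\}$ is a shedding face of the independence complex $I(\mathcal{C})$.
   Context: A clutter $\mathcal{C}$ on finite vertex set $V$ is a set of subsets (circuits) of $V$, none properly containing another. $I(\mathcal{C})$ is the simplicial complex on $V$ of subsets containing no circuit. A neighborhood containment pair of $\mathcal{C}$ is a vertex $v$ and a circuit $e$ with $v\in e$ such that for every circuit $e_2\neq e$ with $v\in e_2$ there exists a circuit $e_3\subseteq(e\cup e_2)\setminus\{v\}$. For a simplicial complex $\Delta$ on vertex set $V$ and a face $\sigma$, $\operatorname{star}_\Delta\sigma$ is the set of faces containing $\sigma$ (and their subsets); $\sigma$ is a shedding face if every face $\tau$ of $\operatorname{star}_\Delta\sigma$ satisfies: for every $u\in\sigma$ there is $w\in V\setminus\tau$ such that $(\tau\cup\{w\})\setminus\{u\}$ is a face of $\Delta$. -}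

module Defs where

open import Data.Nat using (ℕ)
open import Data.Fin using (Fin)
open import Data.Fin.Subset using (Subset; _∈_; _∉_; _⊆_; _⊂_; _∪_; _-_)
open import Data.List using (List)
import Data.List.Membership.Propositional as LM
open import Data.Product using (Σ; ∃; _×_)
open import Relation.Binary.PropositionalEquality using (_≢_)
open import Relation.Nullary using (¬_)

Circuits : ℕ → Set
Circuits n = List (Subset n)

IsClutter : ∀ {n} → Circuits n → Set
IsClutter C = ∀ e₁ e₂ → e₁ LM.∈ C → e₂ LM.∈ C → ¬ (e₁ ⊂ e₂)

IsIndFace : ∀ {n} → Circuits n → Subset n → Set
IsIndFace C τ = ∀ e → e LM.∈ C → ¬ (e ⊆ τ)

IsNCPair : ∀ {n} → Circuits n → Fin n → Subset n → Set
IsNCPair C v e =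
  (e LM.∈ C) × (v ∈ e) ×
  (∀ e₂ → e₂ LM.∈ C → e₂ ≢ e → v ∈ e₂ →
     Σ (Subset _) λ e₃ → (e₃ LM.∈ C) × (e₃ ⊆ ((e ∪ e₂) - v)))

InStar : ∀ {n} → (Subset n → Set) → Subset n → Subset n → Set
InStar Δ σ τ = Σ (Subset _) λ ρ → Δ ρ × (σ ⊆ ρ) × (τ ⊆ ρ)

IsSheddingFace : ∀ {n} → (Subset n → Set) → Subset n → Set
IsSheddingFace {n} Δ σ =
  Δ σ ×
  (∀ τ → InStar Δ σ τ → ∀ u → u ∈ σ →
     Σ (Fin n) λ w → (w ∉ τ) × Δ ((τ ∪ ⁅ w ⁆) - u))
  where open import Data.Fin.Subset using (⁅_⁆)

module Submission where

-- Let (v , e) be a neighbourhood containment pair of a clutter C and put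
-- σ = e - v.  We show that σ is a shedding face of I(C), always using the
-- vertex w = v as the witness.
--
--  * σ is a face: circuits of a clutter are the minimal non-faces, so every
--    proper subset of a circuit is independent, and σ ⊂ e since v ∈ e.
--  * Let τ lie in the star of σ, say τ ⊆ ρ and σ ⊆ ρ with ρ a face, and let
--    u ∈ σ.  Then v ∉ ρ (otherwise e ⊆ ρ), so in particular v ∉ τ; and
--    (τ ∪ {v}) - u is a face: a circuit e₂ inside it satisfies e₂ - v ⊆ τ;
--    if v ∉ e₂ then e₂ ⊆ τ ⊆ ρ, and if v ∈ e₂ then e₂ ≠ e (as u ∈ e but
--    u ∉ e₂), so the pair yields a circuit e₃ ⊆ (e ∪ e₂) - v ⊆ ρ.

open import Defs
open import Data.Nat using (ℕ)
open import Data.Fin using (Fin; _≟_)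
open import Data.Fin.Subset
  using (Subset; _-_; _─_; _∈_; _∉_; _⊆_; _⊂_; _∪_; ⁅_⁆; outside; inside)
open import Data.Fin.Subset.Properties
  using (x∈⁅x⁆; x∈⁅y⁆⇒x≡y; x∈p∪q⁻; p─q⊆p; x∈p∧x≢y⇒x∈p-y; x∈p⇒p-x⊂p; _∈?_)
open import Data.Vec.Base using (here; there; _∷_)
open import Data.Product using (Σ; _×_; _,_)
open import Data.Sum using (inj₁; inj₂)
open import Data.List.Membership.Propositional using () renaming (_∈_ to _∈ᴸ_)
open import Relation.Nullary using (yes; no; contradiction)
open import Relation.Binary.PropositionalEquality using (_≢_; refl)

private
  variable
    n : ℕ
    p q r : Subset n
    x y : Fin n

x∈p─q⇒x∉q : ∀ (p q : Subset n) → x ∈ p ─ q → x ∉ q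
x∈p─q⇒x∉q (inside ∷ p) (outside ∷ q) here ()
x∈p─q⇒x∉q (s ∷ p) (t ∷ q) (there x∈p─q) (there x∈q) = x∈p─q⇒x∉q p q x∈p─q x∈q

x∈p-y⇒x≢y : x ∈ p - y → x ≢ y
x∈p-y⇒x≢y {p = p} {y = y} x∈p-y refl = x∈p─q⇒x∉q p ⁅ y ⁆ x∈p-y (x∈⁅x⁆ y)

x∈p-y⇒x∈p : x ∈ p - y → x ∈ p
x∈p-y⇒x∈p {p = p} {y = y} = p─q⊆p p ⁅ y ⁆

-mono : p ⊆ q → p - y ⊆ q - y
-mono p⊆q x∈p-y = x∈p∧x≢y⇒x∈p-y (p⊆q (x∈p-y⇒x∈p x∈p-y)) (x∈p-y⇒x≢y x∈p-y)

p∪⁅y⁆-y⊆p : ∀ (p : Subset n) y → (p ∪ ⁅ y ⁆) - y ⊆ p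
p∪⁅y⁆-y⊆p p y x∈ with x∈p∪q⁻ p ⁅ y ⁆ (x∈p-y⇒x∈p x∈)
... | inj₁ x∈p = x∈p
... | inj₂ x∈⁅y⁆ = contradiction (x∈⁅y⁆⇒x≡y y x∈⁅y⁆) (x∈p-y⇒x≢y x∈)

y∉p⇒p⊆p-y : y ∉ p → p ⊆ p - y
y∉p⇒p⊆p-y y∉p x∈p = x∈p∧x≢y⇒x∈p-y x∈p λ { refl → y∉p x∈p }

∪-⊆-deleting : ∀ (p q : Subset n) → p - y ⊆ r → q - y ⊆ r → (p ∪ q) - y ⊆ r
∪-⊆-deleting p q p-y⊆r q-y⊆r x∈ with x∈p∪q⁻ p q (x∈p-y⇒x∈p x∈)
... | inj₁ x∈p = p-y⊆r (x∈p∧x≢y⇒x∈p-y x∈p (x∈p-y⇒x≢y x∈))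
... | inj₂ x∈q = q-y⊆r (x∈p∧x≢y⇒x∈p-y x∈q (x∈p-y⇒x≢y x∈))

-⊆-restore : y ∈ q → p - y ⊆ q → p ⊆ q
-⊆-restore {y = y} y∈q p-y⊆q {x} x∈p with x ≟ y
... | yes refl = y∈q
... | no x≢y = p-y⊆q (x∈p∧x≢y⇒x∈p-y x∈p x≢y)

⊆-added-⇒-deleted-⊆ : ∀ (τ : Subset n) y {u} → p ⊆ (τ ∪ ⁅ y ⁆) - u → p - y ⊆ τ
⊆-added-⇒-deleted-⊆ τ y p⊆ x∈ = p∪⁅y⁆-y⊆p τ y (-mono (λ x∈p → x∈p-y⇒x∈p (p⊆ x∈p)) x∈)

proper-subset-of-circuit-is-face : (C : Circuits n) {e σ : Subset n} →
  IsClutter C → e ∈ᴸ C → σ ⊂ e → IsIndFace C σ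
proper-subset-of-circuit-is-face C {e} clutter e∈C (σ⊆e , z , z∈e , z∉σ) e′ e′∈C e′⊆σ =
  clutter e′ e e′∈C e∈C ((λ x∈e′ → σ⊆e (e′⊆σ x∈e′)) , z , z∈e , λ z∈e′ → z∉σ (e′⊆σ z∈e′))

apex-not-in-face : (C : Circuits n) {e ρ : Subset n} (v : Fin n) →
  IsIndFace C ρ → e ∈ᴸ C → e - v ⊆ ρ → v ∉ ρ
apex-not-in-face C v ρ-face e∈C e-v⊆ρ v∈ρ = ρ-face _ e∈C (-⊆-restore v∈ρ e-v⊆ρ)

exchange-for-apex-is-face : (C : Circuits n) {v u : Fin n} {e τ ρ : Subset n} →
  IsNCPair C v e → IsIndFace C ρ → e - v ⊆ ρ → τ ⊆ ρ → u ∈ e →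
  IsIndFace C ((τ ∪ ⁅ v ⁆) - u)
exchange-for-apex-is-face C {v} {u} {e} {τ} {ρ} (_ , _ , containment)
                          ρ-face e-v⊆ρ τ⊆ρ u∈e e₂ e₂∈C e₂⊆ with v ∈? e₂
... | no v∉e₂ = ρ-face e₂ e₂∈C (λ x∈e₂ → τ⊆ρ (e₂-v⊆τ (y∉p⇒p⊆p-y v∉e₂ x∈e₂)))
  where
  e₂-v⊆τ : e₂ - v ⊆ τ
  e₂-v⊆τ = ⊆-added-⇒-deleted-⊆ τ v e₂⊆
... | yes v∈e₂ =
  let (e₃ , e₃∈C , e₃⊆) = containment e₂ e₂∈C e₂≢e v∈e₂
  in ρ-face e₃ e₃∈C (λ x∈e₃ → e∪e₂-v⊆ρ (e₃⊆ x∈e₃))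
  where
  -- e₂ ≠ e because u ∈ e has been deleted from the set containing e₂
  e₂≢e : e₂ ≢ e
  e₂≢e refl = x∈p-y⇒x≢y (e₂⊆ u∈e) refl
  -- both e - v and e₂ - v lie in ρ
  e∪e₂-v⊆ρ : (e ∪ e₂) - v ⊆ ρ
  e∪e₂-v⊆ρ = ∪-⊆-deleting e e₂ e-v⊆ρ (λ x∈ → τ⊆ρ (⊆-added-⇒-deleted-⊆ τ v e₂⊆ x∈))

lemma5p1 : ∀ {n} (C : Circuits n) (v : Fin n) (e : Subset n) →
    IsClutter C → IsNCPair C v e →
    IsSheddingFace (IsIndFace C) (e - v)
lemma5p1 C v e clutter pair@(e∈C , v∈e , _) = σ-face , shedding
  where
  σ-face : IsIndFace C (e - v)
  σ-face = proper-subset-of-circuit-is-face C clutter e∈C (x∈p⇒p-x⊂p v∈e)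

  shedding : ∀ τ → InStar (IsIndFace C) (e - v) τ → ∀ u → u ∈ e - v →
    Σ (Fin _) λ w → (w ∉ τ) × IsIndFace C ((τ ∪ ⁅ w ⁆) - u)
  shedding τ (ρ , ρ-face , σ⊆ρ , τ⊆ρ) u u∈σ =
    v , (λ v∈τ → apex-not-in-face C v ρ-face e∈C σ⊆ρ (τ⊆ρ v∈τ))
      , exchange-for-apex-is-face C pair ρ-face σ⊆ρ τ⊆ρ (x∈p-y⇒x∈p u∈σ)
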